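{- For $\epsilon\ge1$, let $b(\epsilon)$ denote the availability required for a locally recoverable code with symmetric recovery sets to be capable of locally recovering any pattern of $\epsilon$ erasures. Then $b(1)=1$, $b(2)=2$, $b(3)=2$, and $b(4)>3$.
   Context: A linear code $C\subseteq\mathbb{F}_q^n$ has availability $t$ if for every position $i\in[n]$ there are pairwise disjoint recovery sets $A_{i1},\dots,A_{it}\subseteq[n]\setminus\{i\}$ such that, for each $j$, the entry $c_i$ of every codeword $\mathbf c\in C$ is a function of $\mathbf c|_{A_{ij}}$. Write $B_{ij}=A_{ij}\cup\{i\}$. The recovery sets are symmetric if for every $j$, $k\in A_{ij}$ if and only if $i\in A_{kj}$; in particular for each $j$ the distinct sets among $\{B_{ij}\}_{i\in[n]}$ partition $[n]$ (with $B_{kj}=B_{ij}$ whenever $k\in B_{ij}$). Local recovery of a pattern of erasures (at known positions) proceeds by repeatedly recovering an erased position $i$ using some recovery set $A_{ij}$ that contains no currently erased position; a pattern is locally recoverable if all erased positions can be recovered this way. $b(\epsilon)$ is the least $t$ such that every such code with availability $t$ and symmetric recovery sets can locally recover every pattern of $\epsilon$ erasures. -}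

module Defs where

open import Level using (0ℓ)
open import Data.Nat using (ℕ; _<_; _≤_)
open import Data.Fin using (Fin)
open import Data.Fin.Subset using (Subset; _∈_; _∉_; _-_; Empty; ∣_∣)
open import Data.Product using (Σ; ∃; _×_)
open import Relation.Nullary using (¬_)
open import Relation.Binary.PropositionalEquality using (_≡_)
open import Algebra.Bundles using (CommutativeRing)

record FiniteField : Set₁ where
  field
    commRing : CommutativeRing 0ℓ 0ℓ
  open CommutativeRing commRing public
  field
    0≉1     : ¬ (0# ≈ 1#)
    inverse : ∀ x → ¬ (x ≈ 0#) → ∃ λ y → (x * y) ≈ 1#
    q       : ℕ
    enum    : Fin q → Carrier
    enum-surj : ∀ x → ∃ λ a → enum a ≈ x
    enum-inj  : ∀ a b → enum a ≈ enum b → a ≡ b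

module _ (F : FiniteField) where
  open FiniteField F

  Word : ℕ → Set
  Word n = Fin n → Carrier

  record LinearCode (n : ℕ) : Set₁ where
    field
      member   : Word n → Set
      resp-≈   : ∀ {c d} → (∀ i → c i ≈ d i) → member c → member d
      zero-mem : member (λ _ → 0#)
      +-mem    : ∀ {c d} → member c → member d → member (λ i → c i + d i)
      *-mem    : ∀ a {c} → member c → member (λ i → a * c i)

  Determines : ∀ {n} → LinearCode n → Subset n → Fin n → Set
  Determines {n} C A i =
    ∀ c d → LinearCode.member C c → LinearCode.member C d →
      (∀ k → k ∈ A → c k ≈ d k) → c i ≈ d i

-- Families of recovery sets: A i j  is the j-th recovery set of position i

RecoverySets : ℕ → ℕ → Set
RecoverySets n t = Fin n → Fin t → Subset n

IsAvailability : ∀ {n t} → RecoverySets n t → Set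
IsAvailability {n} {t} A =
  (∀ i j → i ∉ A i j) ×
  (∀ i j j' k → k ∈ A i j → k ∈ A i j' → j ≡ j')

-- symmetric recovery sets: k ∈ A i j ⇔ i ∈ A k j, and for every j the
-- sets B i j = A i j ∪ {i} partition [n] (B k j = B i j whenever k ∈ A i j,
-- i.e. for k ∈ A i j : l ∈ A i j, l ≢ k  ⇒  l ∈ A k j)
IsSymmetric : ∀ {n t} → RecoverySets n t → Set
IsSymmetric {n} {t} A =
  (∀ i j k → k ∈ A i j → i ∈ A k j) ×
  (∀ i j k l → k ∈ A i j → l ∈ A i j → ¬ (l ≡ k) → l ∈ A k j)

AreRecoverySetsFor : (F : FiniteField) → ∀ {n t} →
  LinearCode F n → RecoverySets n t → Set
AreRecoverySetsFor F C A = ∀ i j → Determines F C (A i j) i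

data LocallyRecoverable {n t} (A : RecoverySets n t) : Subset n → Set where
  done : ∀ {E} → Empty E → LocallyRecoverable A E
  step : ∀ {E} i j → i ∈ E → (∀ k → k ∈ A i j → k ∉ E) →
         LocallyRecoverable A (E - i) → LocallyRecoverable A E

AvailabilitySuffices : ℕ → ℕ → Set₁
AvailabilitySuffices ε t =
  ∀ (F : FiniteField) (n : ℕ) (C : LinearCode F n) (A : RecoverySets n t) →
    IsAvailability A → IsSymmetric A → AreRecoverySetsFor F C A →
    ∀ (E : Subset n) → ∣ E ∣ ≡ ε → LocallyRecoverable A E

b≡ : ℕ → ℕ → Set₁
b≡ ε v = AvailabilitySuffices ε v × (∀ t → t < v → ¬ AvailabilitySuffices ε t)

b> : ℕ → ℕ → Set₁
b> ε v = ∀ t → t ≤ v → ¬ AvailabilitySuffices ε t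

-- Upper bounds: a position i whose t recovery sets all meet the erasures sees t distinct
-- other erased positions, because the sets are disjoint; so t ≥ ε recovers any ε erasures.
-- For three erasures and two symmetric partitions, if both sets of a are blocked (by b and
-- by c), transitivity of the blocks shows that b's second set is free.
-- Lower bounds: erase all ε positions of the zero code with recovery sets that are never
-- empty, so no first step is possible: no sets at all (t = 0), the complement of each point
-- (t = 1), and for ε = 4 up to three of the perfect matchings of K₄.
module Submission where

open import Defs
open import Data.Bool using (true; false)
open import Data.Bool.Properties using (xor-∧-commutativeRing)
open import Data.Empty using (⊥-elim)
open import Data.Fin using (Fin; zero; suc; inject≤; _≟_)
open import Data.Fin.Patterns using (0F; 1F; 2F; 3F)
open import Data.Fin.Properties using (any?; all?; 2↔Bool; inject≤-injective; 0≢1+n)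
import Data.Fin.Properties as Finₚ
open import Data.Fin.Subset using (Subset; _∈_; _∉_; _-_; Empty; Nonempty; ∣_∣; ⊤; ⁅_⁆; inside; outside)
open import Data.Fin.Subset.Properties
  using (_∈?_; ∈⊤; ∣⊤∣≡n; p─⊥≡p; x∈p∧x≢y⇒x∈p-y; x∈p⇒∣p-x∣<∣p∣; x∈⁅x⁆; x∈⁅y⁆⇒x≡y)
open import Data.Nat using (zero; suc; _≤_; _<_; z≤n; s≤s)
open import Data.Nat.Properties using (suc-injective; n≮0; n≮n; ≤-trans; n≤1+n)
open import Data.Product using (∃; _×_; _,_; proj₁; proj₂)
open import Data.Sum using (_⊎_; inj₁; inj₂)
open import Data.Vec using (_∷_; here; there)
open import Function.Bundles using (Inverse)
open import Relation.Nullary using (¬_; Dec; yes; no)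
open import Relation.Nullary.Decidable using (toWitness; ¬?; _×-dec_; _→-dec_)
open import Relation.Binary.PropositionalEquality using (_≡_; _≢_; refl; sym; trans; cong; subst)

x∈p⇒suc∣p-x∣≡∣p∣ : ∀ {n} {x : Fin n} {p} → x ∈ p → suc ∣ p - x ∣ ≡ ∣ p ∣
x∈p⇒suc∣p-x∣≡∣p∣ {x = zero}  {inside ∷ p}  here       = cong suc (cong ∣_∣ (p─⊥≡p p))
x∈p⇒suc∣p-x∣≡∣p∣ {x = suc x} {inside ∷ p}  (there x∈) = cong suc (x∈p⇒suc∣p-x∣≡∣p∣ x∈)
x∈p⇒suc∣p-x∣≡∣p∣ {x = suc x} {outside ∷ p} (there x∈) = x∈p⇒suc∣p-x∣≡∣p∣ x∈

x∈p∧∣p∣≡1+m⇒∣p-x∣≡m : ∀ {n m} {x : Fin n} {p} → x ∈ p → ∣ p ∣ ≡ suc m → ∣ p - x ∣ ≡ m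
x∈p∧∣p∣≡1+m⇒∣p-x∣≡m x∈p eq = suc-injective (trans (x∈p⇒suc∣p-x∣≡∣p∣ x∈p) eq)

∣p∣≡0⇒Empty : ∀ {n} (p : Subset n) → ∣ p ∣ ≡ 0 → Empty p
∣p∣≡0⇒Empty p eq (x , x∈p) = n≮0 (subst (∣ p - x ∣ <_) eq (x∈p⇒∣p-x∣<∣p∣ x∈p))

x∈p∧y∈p∧∣p∣≡1⇒y≡x : ∀ {n} {x y : Fin n} {p} → x ∈ p → y ∈ p → ∣ p ∣ ≡ 1 → y ≡ x
x∈p∧y∈p∧∣p∣≡1⇒y≡x {x = x} {y} {p} x∈p y∈p eq with y ≟ x
... | yes y≡x = y≡x
... | no  y≢x = ⊥-elim (∣p∣≡0⇒Empty (p - x) (x∈p∧∣p∣≡1+m⇒∣p-x∣≡m x∈p eq) (y , x∈p∧x≢y⇒x∈p-y y∈p y≢x))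

x∉p-x : ∀ {n} (x : Fin n) (p : Subset n) → x ∉ p - x
x∉p-x zero    (_ ∷ p) ()
x∉p-x (suc x) (_ ∷ p) (there x∈p-x) = x∉p-x x p x∈p-x

x∈p-y⇒x≢y : ∀ {n} {x y : Fin n} {p} → x ∈ p - y → x ≢ y
x∈p-y⇒x≢y {x = x} {p = p} x∈p-x refl = x∉p-x x p x∈p-x

∣p∣≡1+m⇒Nonempty : ∀ {n m} (p : Subset n) → ∣ p ∣ ≡ suc m → Nonempty p
∣p∣≡1+m⇒Nonempty (inside  ∷ p) eq = zero , here
∣p∣≡1+m⇒Nonempty (outside ∷ p) eq with ∣p∣≡1+m⇒Nonempty p eq
... | x , x∈p = suc x , there x∈p

injection⇒≤∣p∣ : ∀ {n t} {p : Subset n} (f : Fin t → Fin n) →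
                 (∀ {j j'} → f j ≡ f j' → j ≡ j') → (∀ j → f j ∈ p) → t ≤ ∣ p ∣
injection⇒≤∣p∣ {t = zero}  f f-inj f∈p = z≤n
injection⇒≤∣p∣ {t = suc t} {p} f f-inj f∈p =
  subst (suc t ≤_) (x∈p⇒suc∣p-x∣≡∣p∣ (f∈p zero))
    (s≤s (injection⇒≤∣p∣ (λ j → f (suc j)) (λ e → Finₚ.suc-injective (f-inj e))
      (λ j → x∈p∧x≢y⇒x∈p-y (f∈p (suc j)) (λ e → 0≢1+n (sym (f-inj e))))))

module Recovery {n t} (A : RecoverySets n t) (avail : IsAvailability A) where

  Usable : Subset n → Fin n → Fin t → Set
  Usable E i j = ∀ k → k ∈ A i j → k ∉ E

  Blocker : Subset n → Fin n → Fin t → Fin n → Set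
  Blocker E i j k = k ∈ A i j × k ∈ E

  usable-or-blocked : ∀ E i j → Usable E i j ⊎ ∃ (Blocker E i j)
  usable-or-blocked E i j with any? (λ k → (k ∈? A i j) ×-dec (k ∈? E))
  ... | yes blocked    = inj₂ blocked
  ... | no  unblocked  = inj₁ λ k k∈A k∈E → unblocked (k , k∈A , k∈E)

  usable? : ∀ E i j → Dec (Usable E i j)
  usable? E i j = all? (λ k → (k ∈? A i j) →-dec ¬? (k ∈? E))

  blocker≢self : ∀ {E i j k} → Blocker E i j k → k ≢ i
  blocker≢self {i = i} {j} (k∈A , _) refl = proj₁ avail i j k∈A

  blockers-injective : ∀ {E i j j' k} → Blocker E i j k → Blocker E i j' k → j ≡ j'
  blockers-injective {i = i} {j} {j'} {k} (k∈A , _) (k∈A' , _) = proj₂ avail i j j' k k∈A k∈A'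

  -- Disjointness of the recovery sets of i makes their blockers pairwise distinct.
  all-blocked⇒t≤∣E-i∣ : ∀ {E i} → (∀ j → ∃ (Blocker E i j)) → t ≤ ∣ E - i ∣
  all-blocked⇒t≤∣E-i∣ {E} {i} blocker = injection⇒≤∣p∣ (λ j → proj₁ (blocker j))
    (λ {j} {j'} e → blockers-injective (proj₂ (blocker j)) (subst (Blocker E i j') (sym e) (proj₂ (blocker j'))))
    (λ j → x∈p∧x≢y⇒x∈p-y (proj₂ (proj₂ (blocker j))) (blocker≢self (proj₂ (blocker j))))

  usable-if-∣E∣≤t : ∀ {E i} → i ∈ E → ∣ E ∣ ≤ t → ∃ (Usable E i)
  usable-if-∣E∣≤t {E} {i} i∈E ∣E∣≤t with any? (usable? E i)
  ... | yes usable = usable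
  ... | no  none   = ⊥-elim (n≮n ∣ E - i ∣ (≤-trans (subst (_≤ t) (sym (x∈p⇒suc∣p-x∣≡∣p∣ i∈E)) ∣E∣≤t)
                                                    (all-blocked⇒t≤∣E-i∣ blocker)))
    where
    blocker : ∀ j → ∃ (Blocker E i j)
    blocker j with usable-or-blocked E i j
    ... | inj₁ usable  = ⊥-elim (none (j , usable))
    ... | inj₂ blocked = blocked

  recoverable-if-∣E∣≤t : ∀ E → ∣ E ∣ ≤ t → LocallyRecoverable A E
  recoverable-if-∣E∣≤t E = go ∣ E ∣ E refl
    where
    go : ∀ m E → ∣ E ∣ ≡ m → m ≤ t → LocallyRecoverable A E
    go zero    E eq _ = done (∣p∣≡0⇒Empty E eq)
    go (suc m) E eq 1+m≤t with ∣p∣≡1+m⇒Nonempty E eq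
    ... | i , i∈E with usable-if-∣E∣≤t i∈E (subst (_≤ t) (sym eq) 1+m≤t)
    ...   | j , usable =
      step i j i∈E usable (go m (E - i) (x∈p∧∣p∣≡1+m⇒∣p-x∣≡m i∈E eq) (≤-trans (n≤1+n m) 1+m≤t))

module ThreeErasures {n t} (A : RecoverySets n (suc (suc t)))
                     (avail : IsAvailability A) (symm : IsSymmetric A) where

  open Recovery A avail

  ∈-trans : ∀ {i k l j} → k ∈ A i j → l ∈ A k j → l ≢ i → l ∈ A i j
  ∈-trans {i} {k} {l} {j} k∈Ai l∈Ak l≢i = proj₂ symm k j i l (proj₁ symm i j k k∈Ai) l∈Ak l≢i

  not-in-both : ∀ {i k} → k ∈ A i 0F → k ∉ A i 1F
  not-in-both {i} {k} k∈A₀ k∈A₁ with proj₂ avail i 0F 1F k k∈A₀ k∈A₁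
  ... | ()

  recoverable-after-one : ∀ {E i} → ∣ E ∣ ≡ 3 → i ∈ E → LocallyRecoverable A (E - i)
  recoverable-after-one eq i∈E =
    recoverable-if-∣E∣≤t _ (subst (_≤ suc (suc t)) (sym (x∈p∧∣p∣≡1+m⇒∣p-x∣≡m i∈E eq)) (s≤s (s≤s z≤n)))

  -- An erasure k in the second set of b is a or c; either way symmetry (and, for c,
  -- transitivity of blocks) puts b into the second set of a, which is disjoint from the first.
  usable-after-two-blocked : ∀ {E a b c} → ∣ E ∣ ≡ 3 → a ∈ E →
    Blocker E a 0F b → Blocker E a 1F c → Usable E b 1F
  usable-after-two-blocked {E} {a} {b} {c} eq a∈E (b∈Aa₀ , b∈E) (c∈Aa₁ , c∈E) k k∈Ab₁ k∈E with k ≟ a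
  ... | yes refl = not-in-both b∈Aa₀ (proj₁ symm b 1F k k∈Ab₁)
  ... | no  k≢a  = not-in-both b∈Aa₀ (∈-trans c∈Aa₁ (proj₁ symm b 1F c c∈Ab₁) (blocker≢self (b∈Aa₀ , b∈E)))
    where
    k≢b : k ≢ b
    k≢b refl = proj₁ avail b 1F k∈Ab₁
    c≢b : c ≢ b
    c≢b refl = not-in-both b∈Aa₀ c∈Aa₁
    ∣E-a-b∣≡1 : ∣ E - a - b ∣ ≡ 1
    ∣E-a-b∣≡1 = x∈p∧∣p∣≡1+m⇒∣p-x∣≡m (x∈p∧x≢y⇒x∈p-y b∈E (blocker≢self (b∈Aa₀ , b∈E)))
                                     (x∈p∧∣p∣≡1+m⇒∣p-x∣≡m a∈E eq)
    k≡c : k ≡ c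
    k≡c = x∈p∧y∈p∧∣p∣≡1⇒y≡x
      (x∈p∧x≢y⇒x∈p-y (x∈p∧x≢y⇒x∈p-y c∈E (blocker≢self (c∈Aa₁ , c∈E))) c≢b)
      (x∈p∧x≢y⇒x∈p-y (x∈p∧x≢y⇒x∈p-y k∈E k≢a) k≢b)
      ∣E-a-b∣≡1
    c∈Ab₁ : c ∈ A b 1F
    c∈Ab₁ = subst (_∈ A b 1F) k≡c k∈Ab₁

  recoverable-if-∣E∣≡3 : ∀ E → ∣ E ∣ ≡ 3 → LocallyRecoverable A E
  recoverable-if-∣E∣≡3 E eq with ∣p∣≡1+m⇒Nonempty E eq
  ... | a , a∈E with usable-or-blocked E a 0F | usable-or-blocked E a 1F
  ...   | inj₁ usable      | _                = step a 0F a∈E usable (recoverable-after-one eq a∈E)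
  ...   | inj₂ _           | inj₁ usable      = step a 1F a∈E usable (recoverable-after-one eq a∈E)
  ...   | inj₂ (b , b-blk) | inj₂ (c , c-blk) =
    step b 1F (proj₂ b-blk) (usable-after-two-blocked eq a∈E b-blk c-blk) (recoverable-after-one eq (proj₂ b-blk))

suffices-if-ε≤t : ∀ {ε t} → ε ≤ t → AvailabilitySuffices ε t
suffices-if-ε≤t ε≤t F n C A avail _ _ E ∣E∣≡ε =
  Recovery.recoverable-if-∣E∣≤t A avail E (subst (_≤ _) (sym ∣E∣≡ε) ε≤t)

suffices-3-with-≥2 : ∀ {t} → AvailabilitySuffices 3 (suc (suc t))
suffices-3-with-≥2 F n C A avail symm _ = ThreeErasures.recoverable-if-∣E∣≡3 A avail symm

GF2 : FiniteField
GF2 = record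
  { commRing  = xor-∧-commutativeRing
  ; 0≉1       = λ ()
  ; inverse   = λ { true _ → true , refl ; false false≢false → ⊥-elim (false≢false refl) }
  ; q         = 2
  ; enum      = to
  ; enum-surj = λ x → from x , strictlyInverseˡ x
  ; enum-inj  = λ a b e → trans (sym (strictlyInverseʳ a)) (trans (cong from e) (strictlyInverseʳ b))
  }
  where open Inverse 2↔Bool

zeroCode : (F : FiniteField) → ∀ n → LinearCode F n
zeroCode F n = record
  { member   = λ c → ∀ i → c i ≈ 0#
  ; resp-≈   = λ c≈d c≈0 i → ≈-trans (≈-sym (c≈d i)) (c≈0 i)
  ; zero-mem = λ _ → ≈-refl
  ; +-mem    = λ c≈0 d≈0 i → ≈-trans (+-cong (c≈0 i) (d≈0 i)) (+-identityˡ 0#)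
  ; *-mem    = λ a c≈0 i → ≈-trans (*-congˡ (c≈0 i)) (zeroʳ a)
  }
  where open FiniteField F using (_≈_; 0#; +-cong; +-identityˡ; *-congˡ; zeroʳ)
                            renaming (refl to ≈-refl; sym to ≈-sym; trans to ≈-trans)

zeroCode-recovers : ∀ F {n t} (A : RecoverySets n t) → AreRecoverySetsFor F (zeroCode F n) A
zeroCode-recovers F A i j c d c≈0 d≈0 _ = ≈-trans (c≈0 i) (≈-sym (d≈0 i))
  where open FiniteField F using () renaming (sym to ≈-sym; trans to ≈-trans)

-- Erase every position of the zero code: no recovery set avoids the erasures.
nonempty-sets⇒¬suffices : ∀ {n t} (A : RecoverySets (suc n) t) → IsAvailability A → IsSymmetric A →
                          (∀ i j → Nonempty (A i j)) → ¬ AvailabilitySuffices (suc n) t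
nonempty-sets⇒¬suffices {n} A avail symm nonempty suffices
  with suffices GF2 (suc n) (zeroCode GF2 (suc n)) A avail symm (zeroCode-recovers GF2 A) ⊤ (∣⊤∣≡n (suc n))
... | done empty            = empty (zero , ∈⊤)
... | step i j _ usable _   = usable (proj₁ (nonempty i j)) (proj₂ (nonempty i j)) ∈⊤

¬suffices-without-sets : ∀ n → ¬ AvailabilitySuffices (suc n) 0
¬suffices-without-sets n = nonempty-sets⇒¬suffices (λ _ ()) ((λ _ ()) , (λ _ ())) ((λ _ ()) , (λ _ ())) (λ _ ())

¬suffices-one-set : ∀ n → ¬ AvailabilitySuffices (suc (suc n)) 1
¬suffices-one-set n = nonempty-sets⇒¬suffices everything-else
  ((λ i _ → x∉p-x i ⊤) , (λ { _ zero zero _ _ _ → refl }))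
  ((λ i _ k k∈ → x∈p∧x≢y⇒x∈p-y ∈⊤ (λ i≡k → x∈p-y⇒x≢y k∈ (sym i≡k))) ,
   (λ _ _ _ _ _ _ l≢k → x∈p∧x≢y⇒x∈p-y ∈⊤ l≢k))
  (λ i _ → ∣p∣≡1+m⇒Nonempty (⊤ - i) (x∈p∧∣p∣≡1+m⇒∣p-x∣≡m {x = i} ∈⊤ (∣⊤∣≡n (suc (suc n)))))
  where
  everything-else : RecoverySets (suc (suc n)) 1
  everything-else i _ = ⊤ - i

-- The three perfect matchings of K₄, as involutions.
matching : Fin 3 → Fin 4 → Fin 4
matching 0F 0F = 1F
matching 0F 1F = 0F
matching 0F 2F = 3F
matching 0F 3F = 2F
matching 1F 0F = 2F
matching 1F 1F = 3F
matching 1F 2F = 0F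
matching 1F 3F = 1F
matching 2F 0F = 3F
matching 2F 1F = 2F
matching 2F 2F = 1F
matching 2F 3F = 0F

matching-fixes-nothing : ∀ j i → matching j i ≢ i
matching-fixes-nothing = toWitness {a? = all? λ j → all? λ i → ¬? (matching j i ≟ i)} _

matching-involutive : ∀ j i → matching j (matching j i) ≡ i
matching-involutive = toWitness {a? = all? λ j → all? λ i → matching j (matching j i) ≟ i} _

matchings-disjoint : ∀ j j' i → matching j i ≡ matching j' i → j ≡ j'
matchings-disjoint = toWitness {a? = all? λ j → all? λ j' → all? λ i → (matching j i ≟ matching j' i) →-dec (j ≟ j')} _

¬suffices-4-with-≤3 : ∀ t → t ≤ 3 → ¬ AvailabilitySuffices 4 t
¬suffices-4-with-≤3 t t≤3 = nonempty-sets⇒¬suffices partner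
  ((λ i j k∈ → matching-fixes-nothing (J j) i (sym (x∈⁅y⁆⇒x≡y _ k∈))) ,
   (λ i j j' k k∈ k∈' → inject≤-injective t≤3 t≤3 j j'
      (matchings-disjoint (J j) (J j') i (trans (sym (x∈⁅y⁆⇒x≡y _ k∈)) (x∈⁅y⁆⇒x≡y _ k∈')))))
  ((λ i j k k∈ → subst (λ k → i ∈ ⁅ matching (J j) k ⁆) (sym (x∈⁅y⁆⇒x≡y _ k∈))
                   (subst (λ l → i ∈ ⁅ l ⁆) (sym (matching-involutive (J j) i)) (x∈⁅x⁆ i))) ,
   (λ i j k l k∈ l∈ l≢k → ⊥-elim (l≢k (trans (x∈⁅y⁆⇒x≡y _ l∈) (sym (x∈⁅y⁆⇒x≡y _ k∈))))))
  (λ i j → matching (J j) i , x∈⁅x⁆ _)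
  where
  J : Fin t → Fin 3
  J j = inject≤ j t≤3
  partner : RecoverySets 4 t
  partner i j = ⁅ matching (J j) i ⁆

proposition4p1 : b≡ 1 1 × b≡ 2 2 × b≡ 3 2 × b> 4 3
proposition4p1 =
  (suffices-if-ε≤t (s≤s z≤n) ,
    λ { zero _ → ¬suffices-without-sets 0 ; (suc _) (s≤s ()) }) ,
  (suffices-if-ε≤t (s≤s (s≤s z≤n)) ,
    λ { zero _ → ¬suffices-without-sets 1 ; (suc zero) _ → ¬suffices-one-set 0
      ; (suc (suc _)) (s≤s (s≤s ())) }) ,
  (suffices-3-with-≥2 ,
    λ { zero _ → ¬suffices-without-sets 2 ; (suc zero) _ → ¬suffices-one-set 1
      ; (suc (suc _)) (s≤s (s≤s ())) }) ,
  ¬suffices-4-with-≤3
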